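{- Let $\mathbb{T}=(\Sigma,\mathcal{E})$ be a graded theory. Assume that $\Gamma\vdash_k s\le t$ is derivable and let $u\in\mathsf{sub}(s,t)$ have depth $m$. Then $\Gamma\vdash_m{\downarrow}u$ is derivable. In particular, $\Gamma\vdash_k{\downarrow}s$ and $\Gamma\vdash_k{\downarrow}t$ are derivable.
   Context: A graded signature $\Sigma$: sets $\Sigma(P,n)$ of operation symbols for finite posets $P$ and $n\in\omega$; $\mathrm{ar}(\sigma)=P$, $d(\sigma)=n$; $|P|$ is the underlying set. Terms $\mathsf{T}_{\Sigma,k}(\Gamma)$ over a poset $\Gamma$: each $x\in\Gamma$ has depth $0$; for $\sigma\in\Sigma(P,k)$ and any function $f\colon|P|\to\mathsf{T}_{\Sigma,m}(\Gamma)$, $\sigma(f)$ has depth $k+m$. Subterms: $\mathsf{sub}(x)=\{x\}$, $\mathsf{sub}(\sigma(f))=\{\sigma(f)\}\cup\bigcup_i\mathsf{sub}(f(i))$, $\mathsf{sub}(s,t)=\mathsf{sub}(s)\cup\mathsf{sub}(t)$. An inequation $\Gamma\vdash_k s\le t$ is a pair $s,t\in\mathsf{T}_{\Sigma,k}(\Gamma)$; $\Gamma\vdash_k{\downarrow}t$ means $\Gamma\vdash_k t\le t$. A graded theory $\mathbb{T}=(\Sigma,\mathcal{E})$ has a set $\mathcal{E}$ of inequations (axioms). A uniform substitution $\gamma\colon|\Delta|\to\mathsf{T}_{\Sigma,k}(\Gamma)$ extends to $\bar\gamma$ by $\bar\gamma(x)=\gamma(x)$, $\bar\gamma(\sigma(f))=\sigma(\bar\gamma\cdot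 f)$. Derivability rules: (Var) $\Gamma\vdash_0 x\le y$ for $x\le y$ in $\Gamma$. (Ar) for $f\colon|\mathrm{ar}(\sigma)|\to\mathsf{T}_{\Sigma,k}(\Gamma)$: from $\Gamma\vdash_k f(i)\le f(j)$ for all $i\le j$ infer $\Gamma\vdash_{k+d(\sigma)}{\downarrow}\sigma(f)$. (Trans) from $\Gamma\vdash_k s\le t$, $\Gamma\vdash_k t\le u$ infer $\Gamma\vdash_k s\le u$. (Mon) for $f,g\colon|\mathrm{ar}(\sigma)|\to\mathsf{T}_{\Sigma,k}(\Gamma)$: from $\Gamma\vdash_k f(i)\le g(i)$ for all $i$, $\Gamma\vdash_{k+d(\sigma)}{\downarrow}\sigma(f)$, $\Gamma\vdash_{k+d(\sigma)}{\downarrow}\sigma(g)$ infer $\Gamma\vdash_{k+d(\sigma)}\sigma(f)\le\sigma(g)$. (Ax1) for an axiom $\Delta\vdash_n s\le t$ and $\gamma\colon|\Delta|\to\mathsf{T}_{\Sigma,k}(\Gamma)$: from $\Gamma\vdash_k\gamma(x)\le\gamma(y)$ for all $x\le y$ in $\Delta$ infer $\Gamma\vdash_{n+k}\bar\gamma(s)\le\bar\gamma(t)$. (Ax2) for an axiom $\Delta\vdash_n s\le t$, $\sigma(f)\in\mathsf{sub}(s,t)$ with $f\colon|\mathrm{ar}(\sigma)|\to\mathsf{T}_{\Sigma,m}(\Delta)$, $i\le j$ in $\mathrm{ar}(\sigma)$, and $\gamma\colon|\Delta|\to\mathsf{T}_{\Sigma,k}(\Gamma)$: from $\Gamma\vdash_k\gamma(x)\le\gamma(y)$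 for all $x\le y$ in $\Delta$ infer $\Gamma\vdash_{m+k}\bar\gamma(f(i))\le\bar\gamma(f(j))$. -}

module Defs where

open import Data.Nat using (ℕ; _+_)
open import Data.Nat.Properties using (+-assoc)
open import Data.Fin using (Fin)
open import Data.Sum using (_⊎_)
open import Relation.Binary.PropositionalEquality using (_≡_; sym; subst)

record Pos : Set₁ where
  field
    Carrier : Set
    _≤_     : Carrier → Carrier → Set
    refl    : ∀ {x} → x ≤ x
    trans   : ∀ {x y z} → x ≤ y → y ≤ z → x ≤ z
    antisym : ∀ {x y} → x ≤ y → y ≤ x → x ≡ y

record FinPoset : Set₁ where
  field
    size    : ℕ
    _≤_     : Fin size → Fin size → Set
    refl    : ∀ {x} → x ≤ x
    trans   : ∀ {x y z} → x ≤ y → y ≤ z → x ≤ z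
    antisym : ∀ {x y} → x ≤ y → y ≤ x → x ≡ y

open Pos
open FinPoset

-- Graded signature: the disjoint union of the sets Σ(P,n); each symbol
-- σ carries its arity ar σ = P and depth d σ = n.
record Signature : Set₁ where
  field
    Op : Set
    ar : Op → FinPoset
    d  : Op → ℕ

module Terms (Sg : Signature) where
  open Signature Sg

  data Term (Γ : Pos) : ℕ → Set where
    var : Carrier Γ → Term Γ 0
    op  : (σ : Op) {m : ℕ} → (Fin (size (ar σ)) → Term Γ m) → Term Γ (d σ + m)

  data _∈sub_ {Γ : Pos} : {m : ℕ} → Term Γ m → {n : ℕ} → Term Γ n → Set where
    here  : ∀ {m} {u : Term Γ m} → u ∈sub u
    there : ∀ {m n} {u : Term Γ n} {σ : Op} {f : Fin (size (ar σ)) → Term Γ m}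
            (i : Fin (size (ar σ))) → u ∈sub f i → u ∈sub op σ f

  _∈sub[_,_] : {Γ : Pos} {m n : ℕ} → Term Γ m → Term Γ n → Term Γ n → Set
  u ∈sub[ s , t ] = u ∈sub s ⊎ u ∈sub t

  substT : {Δ Γ : Pos} {k : ℕ} → (Carrier Δ → Term Γ k) → {n : ℕ} → Term Δ n → Term Γ (n + k)
  substT γ (var x) = γ x
  substT {Γ = Γ} {k = k} γ (op σ {m} f) =
    subst (Term Γ) (sym (+-assoc (d σ) m k)) (op σ (λ i → substT γ (f i)))

record Theory : Set₁ where
  field
    sig : Signature
  open Terms sig public
  field
    Ax    : Set
    ctx   : Ax → Pos
    depth : Ax → ℕ
    lhs   : (a : Ax) → Term (ctx a) (depth a)
    rhs   : (a : Ax) → Term (ctx a) (depth a)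

module Derivability (T : Theory) where
  open Theory T
  open Signature sig

  data Der (Γ : Pos) : (k : ℕ) → Term Γ k → Term Γ k → Set where
    Var   : ∀ {x y} → _≤_ Γ x y → Der Γ 0 (var x) (var y)
    Ar    : (σ : Op) {k : ℕ} (f : Fin (size (ar σ)) → Term Γ k) →
            (∀ i j → FinPoset._≤_ (ar σ) i j → Der Γ k (f i) (f j)) →
            Der Γ (d σ + k) (op σ f) (op σ f)
    Trans : ∀ {k s t u} → Der Γ k s t → Der Γ k t u → Der Γ k s u
    Mon   : (σ : Op) {k : ℕ} (f g : Fin (size (ar σ)) → Term Γ k) →
            (∀ i → Der Γ k (f i) (g i)) →
            Der Γ (d σ + k) (op σ f) (op σ f) →
            Der Γ (d σ + k) (op σ g) (op σ g) →
            Der Γ (d σ + k) (op σ f) (op σ g)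
    Ax1   : (a : Ax) {k : ℕ} (γ : Carrier (ctx a) → Term Γ k) →
            (∀ x y → _≤_ (ctx a) x y → Der Γ k (γ x) (γ y)) →
            Der Γ (depth a + k) (substT γ (lhs a)) (substT γ (rhs a))
    Ax2   : (a : Ax) (σ : Op) {m : ℕ} (f : Fin (size (ar σ)) → Term (ctx a) m) →
            op σ f ∈sub[ lhs a , rhs a ] →
            (i j : Fin (size (ar σ))) → FinPoset._≤_ (ar σ) i j →
            {k : ℕ} (γ : Carrier (ctx a) → Term Γ k) →
            (∀ x y → _≤_ (ctx a) x y → Der Γ k (γ x) (γ y)) →
            Der Γ (m + k) (substT γ (f i)) (substT γ (f j))

-- The only non-structural cases are the axiom rules, whose sides are substitution
-- instances γ̄(w): a subterm of γ̄(w) lies either inside some γ x, which is covered by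
-- the induction hypothesis for the premise γ x ≤ γ x, or is γ̄(σ(f)) for a subterm σ(f)
-- of the axiom, and then Ar applies with the premises γ̄(f i) ≤ γ̄(f j) supplied by Ax2.
module Submission where

open import Defs
open import Data.Nat using (ℕ; _+_)
open import Data.Product using (_×_; _,_; proj₁; proj₂)
open import Data.Sum using (inj₁; inj₂; [_,_])
open import Relation.Binary.PropositionalEquality using (_≡_; refl; subst)
open Theory using (Term; _∈sub[_,_])
open Derivability using (Der)

module SubtermDerivability (T : Theory) where
  open Theory T hiding (Term; _∈sub[_,_])
  open Theory T using () renaming (Term to Tm; _∈sub[_,_] to _∈sub[_,_]ᵀ)
  open Signature sig
  open Derivability T using (Var; Ar; Trans; Mon; Ax1; Ax2) renaming (Der to Dv)

  ∈sub-trans : ∀ {Γ m n p} {u : Tm Γ m} {v : Tm Γ n} {w : Tm Γ p} →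
               u ∈sub v → v ∈sub w → u ∈sub w
  ∈sub-trans u∈v here        = u∈v
  ∈sub-trans u∈v (there i q) = there i (∈sub-trans u∈v q)

  ∈sub[]-arg : ∀ {Γ m n} {s t : Tm Γ n} {σ : Op} {f : _ → Tm Γ m} (i : _) →
               op σ f ∈sub[ s , t ]ᵀ → f i ∈sub[ s , t ]ᵀ
  ∈sub[]-arg i (inj₁ σf∈s) = inj₁ (∈sub-trans (there i here) σf∈s)
  ∈sub[]-arg i (inj₂ σf∈t) = inj₂ (∈sub-trans (there i here) σf∈t)

  SubtermsDerivable : ∀ {Γ n} → Tm Γ n → Set
  SubtermsDerivable {Γ} t = ∀ {m} {u : Tm Γ m} → u ∈sub t → Dv Γ m u u

  subtermsDerivable-var : ∀ {Γ} (x : Pos.Carrier Γ) → SubtermsDerivable (var {Γ} x)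
  subtermsDerivable-var {Γ} x here = Var (Pos.refl Γ)

  subtermsDerivable-op : ∀ {Γ m} {σ : Op} {f : _ → Tm Γ m} →
                         Dv Γ (d σ + m) (op σ f) (op σ f) →
                         (∀ i → SubtermsDerivable (f i)) →
                         SubtermsDerivable (op σ f)
  subtermsDerivable-op ↓σf ↓f here        = ↓σf
  subtermsDerivable-op ↓σf ↓f (there i h) = ↓f i h

  subtermsDerivable-subst : ∀ {Γ n n'} (e : n ≡ n') {t : Tm Γ n} →
                            SubtermsDerivable t → SubtermsDerivable (subst (Tm Γ) e t)
  subtermsDerivable-subst refl ↓t = ↓t

  subtermsDerivable-substT :
    ∀ {Γ} (a : Ax) {k} (γ : Pos.Carrier (ctx a) → Tm Γ k) →
    (∀ x y → Pos._≤_ (ctx a) x y → Dv Γ k (γ x) (γ y)) →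
    (∀ x → SubtermsDerivable (γ x)) →
    ∀ {n} (w : Tm (ctx a) n) → w ∈sub[ lhs a , rhs a ]ᵀ →
    SubtermsDerivable (substT γ w)
  subtermsDerivable-substT a γ γ-mono ↓γ (var x) w∈a = ↓γ x
  subtermsDerivable-substT a γ γ-mono ↓γ (op σ f) w∈a =
    subtermsDerivable-subst _
      (subtermsDerivable-op
        (Ar σ (λ i → substT γ (f i)) (λ i j i≤j → Ax2 a σ f w∈a i j i≤j γ γ-mono))
        (λ i → subtermsDerivable-substT a γ γ-mono ↓γ (f i) (∈sub[]-arg i w∈a)))

  der⇒subtermsDerivable : ∀ {Γ k s t} → Dv Γ k s t →
                          SubtermsDerivable s × SubtermsDerivable t
  der⇒subtermsDerivable (Var {x} {y} _) = subtermsDerivable-var x , subtermsDerivable-var y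
  der⇒subtermsDerivable (Ar σ f f-mono) = ↓σf , ↓σf
    where
    ↓σf = subtermsDerivable-op (Ar σ f f-mono)
            (λ i → proj₁ (der⇒subtermsDerivable (f-mono i i (FinPoset.refl (ar σ)))))
  der⇒subtermsDerivable (Trans s≤t t≤u) =
    proj₁ (der⇒subtermsDerivable s≤t) , proj₂ (der⇒subtermsDerivable t≤u)
  der⇒subtermsDerivable (Mon σ f g f≤g ↓σf ↓σg) =
    subtermsDerivable-op ↓σf (λ i → proj₁ (der⇒subtermsDerivable (f≤g i))) ,
    subtermsDerivable-op ↓σg (λ i → proj₂ (der⇒subtermsDerivable (f≤g i)))
  der⇒subtermsDerivable (Ax1 a γ γ-mono) =
    substT↓ (lhs a) (inj₁ here) , substT↓ (rhs a) (inj₂ here)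
    where
    substT↓ = subtermsDerivable-substT a γ γ-mono
                  (λ x → proj₁ (der⇒subtermsDerivable (γ-mono x x (Pos.refl (ctx a)))))
  der⇒subtermsDerivable (Ax2 a σ f σf∈a i j _ γ γ-mono) =
    substT↓ (f i) (∈sub[]-arg i σf∈a) , substT↓ (f j) (∈sub[]-arg j σf∈a)
    where
    substT↓ = subtermsDerivable-substT a γ γ-mono
                  (λ x → proj₁ (der⇒subtermsDerivable (γ-mono x x (Pos.refl (ctx a)))))

mainTheorem7 : (T : Theory) (Γ : Pos) (k : ℕ) (s t : Term T Γ k) →
    Der T Γ k s t →
    ((m : ℕ) (u : Term T Γ m) → _∈sub[_,_] T u s t → Der T Γ m u u)
    × Der T Γ k s s × Der T Γ k t t
mainTheorem7 T Γ k s t s≤t = (λ m u → [ ↓s , ↓t ]) , ↓s here , ↓t here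
  where
  open SubtermDerivability T
  open Theory T using (here)
  ↓s = proj₁ (der⇒subtermsDerivable s≤t)
  ↓t = proj₂ (der⇒subtermsDerivable s≤t)
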